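{- Let $d,m$ be positive integers and $N=m^{2^d}$. There exists a sequence $x_0,\dots,x_{N-1}$ of $N$ points in $\mathbb R^d$ with the following two properties: - it has no monotonic subsequence of length $m+1$; - for each $k=1,\dots,d$, the $k$-th coordinates of the points form a rearrangement of $[N]=\{1,\dots,N\}$.
   Context: A sequence of points in $\mathbb R^d$ is monotonic if, for each coordinate $k$, the sequence of $k$-th coordinates is monotonic (non-decreasing or non-increasing). -}

module Defs where

open import Data.Nat using (ℕ; suc; _≤_)
open import Data.Fin using (Fin; toℕ) renaming (_<_ to _<ᶠ_; _≤_ to _≤ᶠ_)
open import Data.Fin.Permutation using (Permutation′; _⟨$⟩ʳ_)
open import Data.Product using (Σ; _×_)
open import Data.Sum using (_⊎_)
open import Relation.Binary.PropositionalEquality using (_≡_)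

-- A point of ℝ^d whose coordinates are natural numbers.
Point : ℕ → Set
Point d = Fin d → ℕ

NonDecreasing : ∀ {L} → (Fin L → ℕ) → Set
NonDecreasing {L} f = ∀ (i j : Fin L) → i ≤ᶠ j → f i ≤ f j

NonIncreasing : ∀ {L} → (Fin L → ℕ) → Set
NonIncreasing {L} f = ∀ (i j : Fin L) → i ≤ᶠ j → f j ≤ f i

Monotone : ∀ {L} → (Fin L → ℕ) → Set
Monotone f = NonDecreasing f ⊎ NonIncreasing f

MonotonicSeq : ∀ {d L} → (Fin L → Point d) → Set
MonotonicSeq {d} {L} x = ∀ (k : Fin d) → Monotone (λ i → x i k)

StrictlyIncreasing : ∀ {L N} → (Fin L → Fin N) → Set
StrictlyIncreasing {L} σ = ∀ (i j : Fin L) → i <ᶠ j → σ i <ᶠ σ j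

HasMonotonicSubseq : ∀ {d N} → (L : ℕ) → (Fin N → Point d) → Set
HasMonotonicSubseq {d} {N} L x =
  Σ (Fin L → Fin N) λ σ → StrictlyIncreasing σ × MonotonicSeq (λ i → x (σ i))

RearrangementOf[N] : ∀ {N} → (Fin N → ℕ) → Set
RearrangementOf[N] {N} f =
  Σ (Permutation′ N) λ π → ∀ (i : Fin N) → f i ≡ suc (toℕ (π ⟨$⟩ʳ i))

module Submission where

-- The construction is by induction on the dimension d, keeping the points
-- encoded as d permutations π₀,…,π_{d-1} of Fin n: the i-th point has k-th
-- coordinate 1 + π_k(i), so every coordinate is automatically a rearrangement
-- of [n].
--
--  * d = 0, n = m: there are only m points, so no subsequence of length m+1.
--  * d ↦ d+1, n ↦ n²: index the new points by pairs (q , r) ∈ Fin n × Fin n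
--    in lexicographic order ("block" q, position r inside the block).  The new
--    first coordinate ranks (q , n-1-r) lexicographically, the coordinate k+1
--    ranks (π_k q , π_k r) lexicographically.
--
-- Along a subsequence whose first coordinate is monotone, either the block
-- index q strictly increases (first coordinate non-decreasing) or the block
-- index is constant and r strictly increases (first coordinate
-- non-increasing); this is 'across-or-within'.  In the first case the
-- coordinates k+1 being monotone forces π_k q to be monotone, in the second
-- π_k r; either way the old sequence has a monotonic subsequence of the same
-- length.  So each step preserves "no monotonic subsequence of length m+1",
-- and after d steps there are m ^ 2 ^ d points.

open import Defs
open import Data.Nat using (ℕ; suc; zero; _^_; _≤_; _<_; _+_; _*_; s≤s; s≤s⁻¹)
open import Data.Nat.Properties
  using (≤-refl; <⇒≤; <⇒≱; <-irrefl; +-cancelˡ-≤; +-cancelˡ-<; +-identityʳ; ^-identityʳ; ^-distribˡ-+-*; n<1+n; ∸-monoʳ-<)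
open import Data.Fin using (Fin; toℕ; combine; quotient; remainder; opposite)
  renaming (zero to fzero; suc to fsuc; _<_ to _<ᶠ_; _≤_ to _≤ᶠ_)
open import Data.Fin.Properties
  using (toℕ-combine; combine-remQuot; combine-monoˡ-<; opposite-prop; toℕ<n; pigeonhole; ≤∧≢⇒<; <-cmp; ≤-antisym; ≤-total; *↔×)
open import Data.Fin.Permutation using (Permutation′; _⟨$⟩ʳ_; reverse)
open import Data.Vec.Functional using (_∷_)
open import Data.Product using (Σ; _×_; _,_)
open import Data.Product.Function.NonDependent.Propositional using (_×-↔_)
open import Data.Sum using (_⊎_; inj₁; inj₂)
open import Data.Empty using (⊥)
open import Function.Construct.Composition using (_↔-∘_)
open import Function.Construct.Symmetry using (↔-sym)
open import Function.Construct.Identity using (↔-id)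
open import Relation.Binary.Definitions using (tri<; tri≈; tri>)
open import Relation.Nullary using (¬_; contradiction)
open import Relation.Binary.PropositionalEquality

monotone-reflect : ∀ {L} {f g : Fin L → ℕ} →
  (∀ i j → f i ≤ f j → g i ≤ g j) → Monotone f → Monotone g
monotone-reflect reflects (inj₁ nd) = inj₁ λ i j i≤j → reflects i j (nd i j i≤j)
monotone-reflect reflects (inj₂ ni) = inj₂ λ i j i≤j → reflects j i (ni i j i≤j)

strictly-increasing⇒monotone : ∀ {L N} {σ : Fin L → Fin N} → StrictlyIncreasing σ →
  ∀ i j → i ≤ᶠ j → σ i ≤ᶠ σ j
strictly-increasing⇒monotone inc i j i≤j with <-cmp i j
... | tri< i<j _ _ = <⇒≤ (inc i j i<j)
... | tri≈ _ refl _ = ≤-refl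
... | tri> _ _ j<i = contradiction i≤j (<⇒≱ j<i)

short⇒no-subsequence : ∀ {d N L} (x : Fin N → Point d) → N < L → ¬ HasMonotonicSubseq L x
short⇒no-subsequence x N<L (σ , inc , _) with pigeonhole N<L σ
... | i , j , i<j , σi≡σj = <-irrefl (cong toℕ σi≡σj) (inc i j i<j)

combine-reflects-≤ˡ : ∀ {M N} {a a' : Fin M} {b b' : Fin N} →
  combine a b ≤ᶠ combine a' b' → a ≤ᶠ a'
combine-reflects-≤ˡ {a = a} {a'} {b} {b'} le with <-cmp a a'
... | tri< a<a' _ _ = <⇒≤ a<a'
... | tri≈ _ refl _ = ≤-refl
... | tri> _ _ a'<a = contradiction le (<⇒≱ (combine-monoˡ-< b' b a'<a))

combine-reflects-≤ʳ : ∀ {M N} {a a' : Fin M} {b b' : Fin N} → a ≡ a' →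
  combine a b ≤ᶠ combine a' b' → b ≤ᶠ b'
combine-reflects-≤ʳ {N = N} {a} {b = b} {b'} refl le =
  +-cancelˡ-≤ (N * toℕ a) (toℕ b) (toℕ b')
    (subst₂ _≤_ (toℕ-combine a b) (toℕ-combine a b') le)

combine-reflects-<ʳ : ∀ {M N} {a a' : Fin M} {b b' : Fin N} → a ≡ a' →
  combine a b <ᶠ combine a' b' → b <ᶠ b'
combine-reflects-<ʳ {N = N} {a} {b = b} {b'} refl lt =
  +-cancelˡ-< (N * toℕ a) (toℕ b) (toℕ b')
    (subst₂ _<_ (toℕ-combine a b) (toℕ-combine a b') lt)

opposite-reverses-< : ∀ {N} {b b' : Fin N} → b <ᶠ b' → opposite b' <ᶠ opposite b
opposite-reverses-< {N} {b} {b'} b<b' =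
  subst₂ _<_ (sym (opposite-prop b')) (sym (opposite-prop b))
    (∸-monoʳ-< {N} (s≤s b<b') (toℕ<n b'))

blockPerm : ∀ {M N} → Permutation′ M → Permutation′ N → Permutation′ (M * N)
blockPerm {M} {N} π ρ = ↔-sym (*↔× {M} {N}) ↔-∘ ((π ×-↔ ρ) ↔-∘ *↔× {M} {N})

module Blocks {L M N : ℕ} (σ : Fin L → Fin (M * N)) (inc : StrictlyIncreasing σ) where

  q : Fin L → Fin M
  q i = quotient {M} N (σ i)

  r : Fin L → Fin N
  r i = remainder {M} N (σ i)

  split : ∀ i → σ i ≡ combine (q i) (r i)
  split i = sym (combine-remQuot {M} N (σ i))

  ordered : ∀ i j → i <ᶠ j → combine (q i) (r i) <ᶠ combine (q j) (r j)
  ordered i j i<j = subst₂ _<ᶠ_ (split i) (split j) (inc i j i<j)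

  blocks-monotone : ∀ i j → i ≤ᶠ j → q i ≤ᶠ q j
  blocks-monotone i j i≤j =
    combine-reflects-≤ˡ (subst₂ _≤ᶠ_ (split i) (split j) (strictly-increasing⇒monotone inc i j i≤j))

  across-or-within : Monotone (λ i → toℕ (combine (q i) (opposite (r i)))) →
    StrictlyIncreasing q ⊎ ((∀ i j → q i ≡ q j) × StrictlyIncreasing r)
  across-or-within (inj₁ nd) = inj₁ across
    where
    -- Two points in one block would make the reversed positions decrease.
    across : StrictlyIncreasing q
    across i j i<j = ≤∧≢⇒< (blocks-monotone i j (<⇒≤ i<j)) λ same →
      contradiction (combine-reflects-≤ʳ same (nd i j (<⇒≤ i<j)))
        (<⇒≱ (opposite-reverses-< (combine-reflects-<ʳ same (ordered i j i<j))))
  across-or-within (inj₂ ni) = inj₂ (same-block , within)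
    where
    same-block-≤ : ∀ i j → i ≤ᶠ j → q i ≡ q j
    same-block-≤ i j i≤j = ≤-antisym (blocks-monotone i j i≤j) (combine-reflects-≤ˡ (ni i j i≤j))
    same-block : ∀ i j → q i ≡ q j
    same-block i j with ≤-total i j
    ... | inj₁ i≤j = same-block-≤ i j i≤j
    ... | inj₂ j≤i = sym (same-block-≤ j i j≤i)
    within : StrictlyIncreasing r
    within i j i<j = combine-reflects-<ʳ (same-block i j) (ordered i j i<j)

points : ∀ {d n} → (Fin d → Permutation′ n) → Fin n → Point d
points π i k = suc (toℕ (π k ⟨$⟩ʳ i))

Construction : ℕ → ℕ → ℕ → Set
Construction L d n = Σ (Fin d → Permutation′ n) λ π → ¬ HasMonotonicSubseq L (points π)

square-construction : ∀ {L d n} → Construction L d n → Construction L (suc d) (n * n)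
square-construction {L} {d} {n} (π , noLong) = π′ , noLong′
  where
  -- The first coordinate ranks (q , opposite r), coordinate k+1 ranks (π_k q , π_k r).
  π′ : Fin (suc d) → Permutation′ (n * n)
  π′ = blockPerm (↔-id (Fin n)) reverse ∷ λ k → blockPerm (π k) (π k)

  noLong′ : ¬ HasMonotonicSubseq L (points π′)
  noLong′ (σ , inc , mon) = descend (across-or-within (monotone-reflect (λ _ _ → s≤s⁻¹) (mon fzero)))
    where
    open Blocks {M = n} {N = n} σ inc
    -- Coordinate k+1 compares (π_k q , π_k r) lexicographically, so it
    -- reflects the order of π_k q across blocks and of π_k r within a block.
    descend : StrictlyIncreasing q ⊎ ((∀ i j → q i ≡ q j) × StrictlyIncreasing r) → ⊥
    descend (inj₁ across) = noLong (q , across , λ k →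
      monotone-reflect (λ i j le → s≤s (combine-reflects-≤ˡ (s≤s⁻¹ le))) (mon (fsuc k)))
    descend (inj₂ (same-block , within)) = noLong (r , within , λ k →
      monotone-reflect (λ i j le → s≤s (combine-reflects-≤ʳ (cong (π k ⟨$⟩ʳ_) (same-block i j)) (s≤s⁻¹ le)))
        (mon (fsuc k)))

square-exponent : ∀ m d → m ^ (2 ^ suc d) ≡ m ^ (2 ^ d) * m ^ (2 ^ d)
square-exponent m d = begin
  m ^ (2 ^ d + (2 ^ d + 0))      ≡⟨ ^-distribˡ-+-* m (2 ^ d) (2 ^ d + 0) ⟩
  m ^ (2 ^ d) * m ^ (2 ^ d + 0)  ≡⟨ cong (λ e → m ^ (2 ^ d) * m ^ e) (+-identityʳ (2 ^ d)) ⟩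
  m ^ (2 ^ d) * m ^ (2 ^ d)      ∎
  where open ≡-Reasoning

construction : ∀ m d → Construction (suc m) d (m ^ (2 ^ d))
construction m zero = subst (Construction (suc m) 0) (sym (^-identityʳ m))
  ((λ ()) , short⇒no-subsequence (points {0} {m} (λ ())) (n<1+n m))
construction m (suc d) = subst (Construction (suc m) (suc d)) (sym (square-exponent m d))
  (square-construction (construction m d))

lemma2p4 : (d m : ℕ) → 1 ≤ d → 1 ≤ m →
    Σ (Fin (m ^ (2 ^ d)) → Point d) λ x →
    (¬ HasMonotonicSubseq (suc m) x) ×
    (∀ (k : Fin d) → RearrangementOf[N] (λ i → x i k))
lemma2p4 d m _ _ with construction m d
... | π , noLong = points π , noLong , λ k → π k , λ i → refl
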